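{- Let $H$ be a subgroup of $S_m$. For a coset $K=\{y\circ h:h\in H\}$ ($y\in S_m$) let $g(K)=\frac1{|H|}\sum_{z\in K}\rho^1(z)$. Then there is a matrix $M$ (depending only on $H$) such that $g(K)g(K)^t=M$ for every such coset $K$. Moreover, if $H$ is a fixing subgroup then $M\neq0$. Consequently, for any $H$-social aggregator $f:S_m^n\to S_m/H$, the function $x\mapsto g(f(x))$ satisfies $g(f(x))g(f(x))^t=M$ for all $x$.
   Context: $S_m$ is the symmetric group on $[m]$, $\circ$ ordinary composition. $\rho^1$: with $P(z)_{ab}=\mathbf 1_{z(a)=b}$ and $U$ an orthogonal $m\times m$ matrix with first column $\frac1{\sqrt m}(1,\dots,1)^t$, $\rho^1(z)$ is the $(m-1)\times(m-1)$ block in $U^tP(z)U=1\oplus\rho^1(z)$. A subgroup $H$ is fixing if for some partition of $[m]$ into $k\ge2$ nonempty blocks $B_1,\dots,B_k$, $H=\{h:h(B_l)=B_l\ \forall l\}$. $S_m/H$ denotes the set of cosets $\{y\circ h:h\in H\}$, and an $H$-social aggregator is any map $S_m^n\to S_m/H$. -}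

module Defs where

open import Level using (Level)
open import Data.Nat using (ℕ; zero; suc; _≤_)
open import Data.Fin using (Fin; _≟_) renaming (zero to fzero; suc to fsuc)
open import Data.Fin.Permutation using (Permutation′; _⟨$⟩ʳ_; _⟨$⟩ˡ_)
open import Data.List using (List; length; foldr; map)
open import Data.List.Relation.Unary.Any using (Any)
open import Data.List.Relation.Unary.AllPairs using (AllPairs)
open import Data.Product using (Σ; _×_; _,_; ∃)
open import Relation.Binary.PropositionalEquality using (_≡_)
open import Relation.Nullary using (¬_; yes; no)
open import Algebra.Bundles using (CommutativeRing)

_≈ₚ_ : ∀ {m} → Permutation′ m → Permutation′ m → Set
π ≈ₚ σ = ∀ i → π ⟨$⟩ʳ i ≡ σ ⟨$⟩ʳ i

_∈ₚ_ : ∀ {m} → Permutation′ m → List (Permutation′ m) → Set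
π ∈ₚ hs = Any (π ≈ₚ_) hs

record IsSubgroupList (m : ℕ) (hs : List (Permutation′ m)) : Set where
  field
    noDup   : AllPairs (λ π σ → ¬ (π ≈ₚ σ)) hs
    hasId   : Σ (Permutation′ m) (λ e → (∀ i → e ⟨$⟩ʳ i ≡ i) × (e ∈ₚ hs))
    closed∘ : ∀ π σ → π ∈ₚ hs → σ ∈ₚ hs →
              Σ (Permutation′ m) (λ τ → (∀ i → τ ⟨$⟩ʳ i ≡ π ⟨$⟩ʳ (σ ⟨$⟩ʳ i)) × (τ ∈ₚ hs))
    closed⁻¹ : ∀ π → π ∈ₚ hs →
              Σ (Permutation′ m) (λ τ → (∀ i → τ ⟨$⟩ʳ i ≡ π ⟨$⟩ˡ i) × (τ ∈ₚ hs))

-- H is fixing: there is a partition of [m] into k ≥ 2 nonempty blocks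
-- B_l = { a | blk a ≡ l } such that H = { h | h(B_l) = B_l for all l }.
IsFixing : (m : ℕ) → List (Permutation′ m) → Set
IsFixing m hs =
  Σ ℕ λ k → Σ (Fin m → Fin k) λ blk →
    (2 ≤ k) × (∀ l → ∃ λ a → blk a ≡ l) ×
    (∀ (h : Permutation′ m) →
      ((h ∈ₚ hs) →
         (∀ a → blk (h ⟨$⟩ʳ a) ≡ blk a) × (∀ a → ∃ λ a′ → blk a′ ≡ blk a × h ⟨$⟩ʳ a′ ≡ a))
      × ((∀ a → blk (h ⟨$⟩ʳ a) ≡ blk a) × (∀ a → ∃ λ a′ → blk a′ ≡ blk a × h ⟨$⟩ʳ a′ ≡ a)
         → h ∈ₚ hs))

module _ {c ℓ : Level} (R : CommutativeRing c ℓ) where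
  open CommutativeRing R

  Mat : ℕ → ℕ → Set c
  Mat p q = Fin p → Fin q → Carrier

  ℕ→R : ℕ → Carrier
  ℕ→R zero = 0#
  ℕ→R (suc n) = 1# + ℕ→R n

  ΣFin : (p : ℕ) → (Fin p → Carrier) → Carrier
  ΣFin zero f = 0#
  ΣFin (suc p) f = f fzero + ΣFin p (λ i → f (fsuc i))

  _⊗_ : ∀ {p q r} → Mat p q → Mat q r → Mat p r
  (A ⊗ B) i j = ΣFin _ (λ k → A i k * B k j)

  ᵗ : ∀ {p q} → Mat p q → Mat q p
  ᵗ A i j = A j i

  I : ∀ {p} → Mat p p
  I i j with i ≟ j
  ... | yes _ = 1#
  ... | no _ = 0#

  _≈M_ : ∀ {p q} → Mat p q → Mat p q → Set ℓ
  A ≈M B = ∀ i j → A i j ≈ B i j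

  P : ∀ {m} → (Fin m → Fin m) → Mat m m
  P z a b with z a ≟ b
  ... | yes _ = 1#
  ... | no _ = 0#

  -- U is orthogonal with first column (1/√m)(1,…,1)^t, where s plays 1/√m
  record IsGoodU (m′ : ℕ) (U : Mat (suc m′) (suc m′)) : Set (c Level.⊔ ℓ) where
    field
      s        : Carrier
      s²m≈1    : s * s * ℕ→R (suc m′) ≈ 1#
      orthᵗ    : (ᵗ U ⊗ U) ≈M I
      orth     : (U ⊗ ᵗ U) ≈M I
      firstCol : ∀ a → U a fzero ≈ s

  ρ¹ : ∀ {m′} → Mat (suc m′) (suc m′) → (Fin (suc m′) → Fin (suc m′)) → Mat m′ m′
  ρ¹ U z i j = ((ᵗ U ⊗ P z) ⊗ U) (fsuc i) (fsuc j)

  -- g(K) for the coset K = { y ∘ h | h ∈ H }:  (1/|H|) Σ_{z ∈ K} ρ¹(z)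
  -- = (1/|H|) Σ_{h ∈ H} ρ¹(y ∘ h); hinv plays 1/|H|.
  gCoset : ∀ {m′} → Mat (suc m′) (suc m′) → List (Permutation′ (suc m′)) → Carrier →
           Permutation′ (suc m′) → Mat m′ m′
  gCoset U hs hinv y i j =
    hinv * foldr _+_ 0# (map (λ h → ρ¹ U (λ a → y ⟨$⟩ʳ (h ⟨$⟩ʳ a)) i j) hs)

module Submission where

-- Write F(z) = Uᵗ P(z) U for the full conjugated permutation
-- matrix, so that ρ¹(z) is the lower-right block of F(z), and put
-- Q(y) = (1/|H|) Σ_{h∈H} P(y∘h), Q = Q(id), W = Q Qᵗ.  With the convention
-- P(z)_{ab} = [z a = b] one has P(y∘h) = P(h) P(y), hence Q(y) = Q P(y), and
-- since P(y) is orthogonal, Q(y) Q(y)ᵗ = W for every y.  The full coset mean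
-- G(y) = (1/|H|) Σ_h F(y∘h) equals Uᵗ Q(y) U, and because Q(y) has row sums 1
-- and the first column of U is constant, the first column of G(y) is e₀.
-- Therefore g(yH) g(yH)ᵗ is the lower-right block M of Uᵗ W U, independent of y.
-- If H is fixing and M = 0, then (W being doubly stochastic) Uᵗ W U = e₀e₀ᵗ,
-- so W = U e₀e₀ᵗ Uᵗ has every entry equal to s² = 1/m; but Q, hence W,
-- vanishes between points of different blocks, forcing s² = 0 and 1 = s²m = 0.
--
-- Everything is done over an arbitrary commutative ring (s plays 1/√m and
-- hinv plays 1/|H|).  The aggregator part holds because
-- f(x) is itself a coset representative.

open import Defs
open import Level using (Level)
open import Data.Nat using (ℕ; suc; zero; s≤s)
open import Data.Fin using (Fin; _≟_) renaming (zero to fzero; suc to fsuc)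
open import Data.Fin.Properties using (suc-injective)
open import Data.Fin.Permutation using (Permutation′; _⟨$⟩ʳ_; _⟨$⟩ˡ_; inverseʳ)
open import Data.List using (List; []; _∷_; length; foldr; map)
open import Data.List.Relation.Unary.Any using (here; there)
open import Data.Product using (Σ; _×_; _,_; proj₁; proj₂)
open import Function.Definitions using (Injective)
open import Function.Bundles using (Injection)
open import Function.Properties.Inverse using (↔⇒↣)
open import Data.Empty using (⊥-elim)
open import Relation.Binary.PropositionalEquality as ≡ using (_≡_)
open import Relation.Nullary using (¬_; yes; no)
open import Algebra.Bundles using (CommutativeRing)
open import Relation.Binary.Bundles using (Setoid)
import Data.Vec.Functional.Relation.Binary.Equality.Setoid as PointwiseEq
import Relation.Binary.Reasoning.Setoid as SetoidReasoning

module LinearAlgebra {c ℓ} (R : CommutativeRing c ℓ) where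
  open CommutativeRing R
  import Algebra.Properties.Semiring.Sum semiring as Sum
  import Algebra.Properties.CommutativeSemigroup *-commutativeSemigroup as *-Comm

  -- Finite sums.  Defs fixes its own recursion ΣFin; it agrees with the
  -- library's `sum`, whose algebraic laws we transport.
  ∑ : (p : ℕ) → (Fin p → Carrier) → Carrier
  ∑ = ΣFin R

  ∑≈sum : ∀ {p} (f : Fin p → Carrier) → ∑ p f ≈ Sum.sum f
  ∑≈sum {zero} f = refl
  ∑≈sum {suc p} f = +-congˡ (∑≈sum (λ i → f (fsuc i)))

  via-sum : ∀ {p} {f g : Fin p → Carrier} → Sum.sum f ≈ Sum.sum g → ∑ p f ≈ ∑ p g
  via-sum {f = f} {g} e = trans (∑≈sum f) (trans e (sym (∑≈sum g)))

  ∑-cong : ∀ {p} {f g : Fin p → Carrier} → (∀ i → f i ≈ g i) → ∑ p f ≈ ∑ p g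
  ∑-cong {f = f} {g} e = via-sum {f = f} {g} (Sum.sum-cong-≋ e)

  ∑-zero : ∀ {p} {f : Fin p → Carrier} → (∀ i → f i ≈ 0#) → ∑ p f ≈ 0#
  ∑-zero {p} {f} e = trans (∑≈sum f) (trans (Sum.sum-cong-≋ e) (Sum.sum-replicate-zero p))

  ∑-+ : ∀ {p} (f g : Fin p → Carrier) → ∑ p (λ i → f i + g i) ≈ ∑ p f + ∑ p g
  ∑-+ f g = trans (∑≈sum (λ i → f i + g i)) (trans (Sum.∑-distrib-+ f g) (sym (+-cong (∑≈sum f) (∑≈sum g))))

  ∑-*ˡ : ∀ {p} x (f : Fin p → Carrier) → x * ∑ p f ≈ ∑ p (λ i → x * f i)
  ∑-*ˡ x f = trans (*-congˡ (∑≈sum f)) (trans (Sum.*-distribˡ-sum x f) (sym (∑≈sum (λ i → x * f i))))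

  ∑-*ʳ : ∀ {p} x (f : Fin p → Carrier) → ∑ p f * x ≈ ∑ p (λ i → f i * x)
  ∑-*ʳ x f = trans (*-congʳ (∑≈sum f)) (trans (Sum.*-distribʳ-sum x f) (sym (∑≈sum (λ i → f i * x))))

  ∑-comm : ∀ {p q} (f : Fin p → Fin q → Carrier) →
           ∑ p (λ i → ∑ q (f i)) ≈ ∑ q (λ j → ∑ p (λ i → f i j))
  ∑-comm {p} {q} f = begin
      ∑ p (λ i → ∑ q (f i))                ≈⟨ ∑-cong (λ i → ∑≈sum (f i)) ⟩
      ∑ p (λ i → Sum.sum (f i))            ≈⟨ ∑≈sum (λ i → Sum.sum (f i)) ⟩
      Sum.sum (λ i → Sum.sum (f i))        ≈⟨ Sum.∑-comm f ⟩
      Sum.sum (λ j → Sum.sum (λ i → f i j)) ≈⟨ sym (∑≈sum (λ j → Sum.sum (λ i → f i j))) ⟩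
      ∑ q (λ j → Sum.sum (λ i → f i j))    ≈⟨ ∑-cong (λ j → sym (∑≈sum (λ i → f i j))) ⟩
      ∑ q (λ j → ∑ p (λ i → f i j))        ∎
    where open SetoidReasoning setoid

  Id : ∀ {p} → Mat R p p
  Id = I R

  Id-diag : ∀ {p} (i : Fin p) → Id i i ≡ 1#
  Id-diag i with i ≟ i
  ... | yes _ = ≡.refl
  ... | no i≢i = ⊥-elim (i≢i ≡.refl)

  Id-off : ∀ {p} {i j : Fin p} → ¬ i ≡ j → Id i j ≡ 0#
  Id-off {i = i} {j} i≢j with i ≟ j
  ... | yes i≡j = ⊥-elim (i≢j i≡j)
  ... | no _ = ≡.refl

  Id-sym : ∀ {p} (i j : Fin p) → Id i j ≡ Id j i
  Id-sym i j with i ≟ j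
  ... | yes ≡.refl = ≡.sym (Id-diag i)
  ... | no i≢j = ≡.sym (Id-off (λ j≡i → i≢j (≡.sym j≡i)))

  Id-injective : ∀ {p q} (f : Fin p → Fin q) → Injective _≡_ _≡_ f →
                 ∀ i j → Id (f i) (f j) ≡ Id i j
  Id-injective f inj i j with i ≟ j
  ... | yes ≡.refl = Id-diag (f i)
  ... | no i≢j = Id-off (λ e → i≢j (inj e))

  ∑-select : ∀ {p} (k : Fin p) (v : Fin p → Carrier) → ∑ p (λ b → Id k b * v b) ≈ v k
  ∑-select {suc p} fzero v =
    trans (+-cong (*-identityˡ (v fzero)) (∑-zero (λ b → zeroˡ (v (fsuc b))))) (+-identityʳ (v fzero))
  ∑-select {suc p} (fsuc k) v = trans (+-cong (zeroˡ (v fzero)) shifted) (+-identityˡ (v (fsuc k)))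
    where
    shifted : ∑ p (λ b → Id (fsuc k) (fsuc b) * v (fsuc b)) ≈ v (fsuc k)
    shifted = trans (∑-cong (λ b → *-congʳ (reflexive (Id-injective fsuc suc-injective k b))))
                    (∑-select k (λ b → v (fsuc b)))

  ∑-Id : ∀ {p} (k : Fin p) → ∑ p (Id k) ≈ 1#
  ∑-Id k = trans (∑-cong (λ b → sym (*-identityʳ (Id k b)))) (∑-select k (λ _ → 1#))

  infixl 7 _·_
  _·_ : ∀ {p q r} → Mat R p q → Mat R q r → Mat R p r
  _·_ = _⊗_ R

  infix 8 _ᵀ
  _ᵀ : ∀ {p q} → Mat R p q → Mat R q p
  A ᵀ = ᵗ R A

  infix 4 _≈ₘ_
  _≈ₘ_ : ∀ {p q} → Mat R p q → Mat R p q → Set ℓ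
  _≈ₘ_ = _≈M_ R

  Mat-setoid : ℕ → ℕ → Setoid c ℓ
  Mat-setoid p q = PointwiseEq.≋-setoid (PointwiseEq.≋-setoid setoid q) p

  ≈ₘ-refl : ∀ {p q} {A : Mat R p q} → A ≈ₘ A
  ≈ₘ-refl i j = refl

  ≈ₘ-sym : ∀ {p q} {A B : Mat R p q} → A ≈ₘ B → B ≈ₘ A
  ≈ₘ-sym e i j = sym (e i j)

  ≈ₘ-trans : ∀ {p q} {A B C : Mat R p q} → A ≈ₘ B → B ≈ₘ C → A ≈ₘ C
  ≈ₘ-trans e f i j = trans (e i j) (f i j)

  ·-cong : ∀ {p q r} {A A′ : Mat R p q} {B B′ : Mat R q r} → A ≈ₘ A′ → B ≈ₘ B′ → A · B ≈ₘ A′ · B′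
  ·-cong eA eB i j = ∑-cong (λ k → *-cong (eA i k) (eB k j))

  ·-congˡ : ∀ {p q r} (A : Mat R p q) {B B′ : Mat R q r} → B ≈ₘ B′ → A · B ≈ₘ A · B′
  ·-congˡ A = ·-cong (≈ₘ-refl {A = A})

  ·-congʳ : ∀ {p q r} {A A′ : Mat R p q} (B : Mat R q r) → A ≈ₘ A′ → A · B ≈ₘ A′ · B
  ·-congʳ B eA = ·-cong eA (≈ₘ-refl {A = B})

  ·-assoc : ∀ {p q r t} (A : Mat R p q) (B : Mat R q r) (C : Mat R r t) → (A · B) · C ≈ₘ A · (B · C)
  ·-assoc {q = q} {r} A B C i j = begin
      ∑ r (λ k → ∑ q (λ l → A i l * B l k) * C k j)
        ≈⟨ ∑-cong (λ k → ∑-*ʳ (C k j) (λ l → A i l * B l k)) ⟩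
      ∑ r (λ k → ∑ q (λ l → A i l * B l k * C k j))
        ≈⟨ ∑-comm (λ k l → A i l * B l k * C k j) ⟩
      ∑ q (λ l → ∑ r (λ k → A i l * B l k * C k j))
        ≈⟨ ∑-cong (λ l → ∑-cong (λ k → *-assoc (A i l) (B l k) (C k j))) ⟩
      ∑ q (λ l → ∑ r (λ k → A i l * (B l k * C k j)))
        ≈⟨ ∑-cong (λ l → sym (∑-*ˡ (A i l) (λ k → B l k * C k j))) ⟩
      ∑ q (λ l → A i l * ∑ r (λ k → B l k * C k j)) ∎
    where open SetoidReasoning setoid

  ᵀ-· : ∀ {p q r} (A : Mat R p q) (B : Mat R q r) → (A · B) ᵀ ≈ₘ B ᵀ · A ᵀ
  ᵀ-· A B i j = ∑-cong (λ k → *-comm (A j k) (B k i))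

  ·-idˡ : ∀ {p q} (A : Mat R p q) → Id · A ≈ₘ A
  ·-idˡ A i j = ∑-select i (λ k → A k j)

  ·-idʳ : ∀ {p q} (A : Mat R p q) → A · Id ≈ₘ A
  ·-idʳ A i j =
    trans (∑-cong (λ k → trans (*-comm (A i k) (Id k j)) (*-congʳ (reflexive (Id-sym k j)))))
          (∑-select j (A i))

  gram-orthogonal : ∀ {p q} (X : Mat R p q) {Y : Mat R q q} → Y · Y ᵀ ≈ₘ Id →
                    (X · Y) · (X · Y) ᵀ ≈ₘ X · X ᵀ
  gram-orthogonal X {Y} YYᵀ≈I = begin
      (X · Y) · (X · Y) ᵀ     ≈⟨ ·-congˡ (X · Y) (ᵀ-· X Y) ⟩
      (X · Y) · (Y ᵀ · X ᵀ)   ≈⟨ ·-assoc X Y (Y ᵀ · X ᵀ) ⟩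
      X · (Y · (Y ᵀ · X ᵀ))   ≈⟨ ·-congˡ X (≈ₘ-sym (·-assoc Y (Y ᵀ) (X ᵀ))) ⟩
      X · ((Y · Y ᵀ) · X ᵀ)   ≈⟨ ·-congˡ X (·-congʳ (X ᵀ) YYᵀ≈I) ⟩
      X · (Id · X ᵀ)          ≈⟨ ·-congˡ X (·-idˡ (X ᵀ)) ⟩
      X · X ᵀ                 ∎
    where open SetoidReasoning (Mat-setoid _ _)

  lower : ∀ {p q} → Mat R (suc p) (suc q) → Mat R p q
  lower A i j = A (fsuc i) (fsuc j)

  lower-· : ∀ {p q r} (A : Mat R (suc p) (suc q)) (B : Mat R (suc q) (suc r)) →
            (∀ i → A (fsuc i) fzero ≈ 0#) → lower A · lower B ≈ₘ lower (A · B)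
  lower-· A B col₀ i j =
    sym (trans (+-congʳ (trans (*-congʳ (col₀ i)) (zeroˡ (B fzero (fsuc j))))) (+-identityˡ _))

  e₀e₀ᵀ : ∀ {p} → Mat R (suc p) (suc p)
  e₀e₀ᵀ a b = Id fzero a * Id fzero b

  sandwich-e₀e₀ᵀ : ∀ {p q r} (A : Mat R p (suc q)) (B : Mat R (suc q) r) a b →
                   ((A · e₀e₀ᵀ) · B) a b ≈ A a fzero * B fzero b
  sandwich-e₀e₀ᵀ {q = q} A B a b = begin
      ∑ (suc q) (λ l → (A · e₀e₀ᵀ) a l * B l b)
        ≈⟨ ∑-cong (λ l → *-congʳ {B l b} (left l)) ⟩
      ∑ (suc q) (λ l → A a fzero * Id fzero l * B l b)
        ≈⟨ ∑-cong (λ l → *-Comm.xy∙z≈y∙xz (A a fzero) (Id fzero l) (B l b)) ⟩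
      ∑ (suc q) (λ l → Id fzero l * (A a fzero * B l b))
        ≈⟨ ∑-select fzero (λ l → A a fzero * B l b) ⟩
      A a fzero * B fzero b ∎
    where
    open SetoidReasoning setoid
    left : ∀ l → (A · e₀e₀ᵀ) a l ≈ A a fzero * Id fzero l
    left l = trans (∑-cong (λ k → *-Comm.x∙yz≈y∙xz (A a k) (Id fzero k) (Id fzero l)))
                   (∑-select fzero (λ k → A a k * Id fzero l))

  lsum : ∀ {A : Set} → List A → (A → Carrier) → Carrier
  lsum hs φ = foldr _+_ 0# (map φ hs)

  lsum-cong : ∀ {A : Set} (hs : List A) {φ ψ : A → Carrier} → (∀ h → φ h ≈ ψ h) → lsum hs φ ≈ lsum hs ψ
  lsum-cong []       e = refl
  lsum-cong (h ∷ hs) e = +-cong (e h) (lsum-cong hs e)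

  lsum-*ˡ : ∀ {A : Set} (hs : List A) x (φ : A → Carrier) → x * lsum hs φ ≈ lsum hs (λ h → x * φ h)
  lsum-*ˡ []       x φ = zeroʳ x
  lsum-*ˡ (h ∷ hs) x φ = trans (distribˡ x (φ h) _) (+-congˡ (lsum-*ˡ hs x φ))

  lsum-*ʳ : ∀ {A : Set} (hs : List A) x (φ : A → Carrier) → lsum hs φ * x ≈ lsum hs (λ h → φ h * x)
  lsum-*ʳ []       x φ = zeroˡ x
  lsum-*ʳ (h ∷ hs) x φ = trans (distribʳ x (φ h) _) (+-congˡ (lsum-*ʳ hs x φ))

  ∑-lsum : ∀ {A : Set} {p} (hs : List A) (φ : A → Fin p → Carrier) →
           ∑ p (λ i → lsum hs (λ h → φ h i)) ≈ lsum hs (λ h → ∑ p (φ h))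
  ∑-lsum {p = p} [] φ = ∑-zero {p} (λ i → refl)
  ∑-lsum (h ∷ hs) φ = trans (∑-+ (φ h) _) (+-congˡ (∑-lsum hs φ))

  lsum-ones : ∀ {A : Set} (hs : List A) {φ : A → Carrier} → (∀ h → φ h ≈ 1#) → lsum hs φ ≈ ℕ→R R (length hs)
  lsum-ones []       e = refl
  lsum-ones (h ∷ hs) e = +-cong (e h) (lsum-ones hs e)

  lsum-zero : ∀ {m} (hs : List (Permutation′ m)) {φ : Permutation′ m → Carrier} →
              (∀ h → h ∈ₚ hs → φ h ≈ 0#) → lsum hs φ ≈ 0#
  lsum-zero []       e = refl
  lsum-zero (h ∷ hs) e =
    trans (+-cong (e h (here (λ _ → ≡.refl))) (lsum-zero hs (λ h′ h′∈hs → e h′ (there h′∈hs))))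
          (+-identityʳ 0#)

  wsum : ∀ {A : Set} {p q} → Carrier → List A → (A → Mat R p q) → Mat R p q
  wsum w hs Φ a b = w * lsum hs (λ h → Φ h a b)

  wsum-cong : ∀ {A : Set} {p q} w (hs : List A) {Φ Ψ : A → Mat R p q} →
              (∀ h → Φ h ≈ₘ Ψ h) → wsum w hs Φ ≈ₘ wsum w hs Ψ
  wsum-cong w hs e a b = *-congˡ (lsum-cong hs (λ h → e h a b))

  wsum-·ʳ : ∀ {A : Set} {p q r} w (hs : List A) (Φ : A → Mat R p q) (B : Mat R q r) →
            wsum w hs Φ · B ≈ₘ wsum w hs (λ h → Φ h · B)
  wsum-·ʳ {q = q} w hs Φ B i j = begin
      ∑ q (λ k → w * lsum hs (λ h → Φ h i k) * B k j)
        ≈⟨ ∑-cong (λ k → *-assoc w _ (B k j)) ⟩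
      ∑ q (λ k → w * (lsum hs (λ h → Φ h i k) * B k j))
        ≈⟨ sym (∑-*ˡ w (λ k → lsum hs (λ h → Φ h i k) * B k j)) ⟩
      w * ∑ q (λ k → lsum hs (λ h → Φ h i k) * B k j)
        ≈⟨ *-congˡ (∑-cong (λ k → lsum-*ʳ hs (B k j) (λ h → Φ h i k))) ⟩
      w * ∑ q (λ k → lsum hs (λ h → Φ h i k * B k j))
        ≈⟨ *-congˡ (∑-lsum hs (λ h k → Φ h i k * B k j)) ⟩
      w * lsum hs (λ h → (Φ h · B) i j) ∎
    where open SetoidReasoning setoid

  wsum-·ˡ : ∀ {A : Set} {p q r} w (hs : List A) (B : Mat R p q) (Φ : A → Mat R q r) →
            B · wsum w hs Φ ≈ₘ wsum w hs (λ h → B · Φ h)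
  wsum-·ˡ {q = q} w hs B Φ i j = begin
      ∑ q (λ k → B i k * (w * lsum hs (λ h → Φ h k j)))
        ≈⟨ ∑-cong (λ k → *-Comm.x∙yz≈y∙xz (B i k) w _) ⟩
      ∑ q (λ k → w * (B i k * lsum hs (λ h → Φ h k j)))
        ≈⟨ sym (∑-*ˡ w (λ k → B i k * lsum hs (λ h → Φ h k j))) ⟩
      w * ∑ q (λ k → B i k * lsum hs (λ h → Φ h k j))
        ≈⟨ *-congˡ (∑-cong (λ k → lsum-*ˡ hs (B i k) (λ h → Φ h k j))) ⟩
      w * ∑ q (λ k → lsum hs (λ h → B i k * Φ h k j))
        ≈⟨ *-congˡ (∑-lsum hs (λ h k → B i k * Φ h k j)) ⟩
      w * lsum hs (λ h → (B · Φ h) i j) ∎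
    where open SetoidReasoning setoid

  -- Stochastic matrices: every row sums to 1; bistochastic: rows and columns.
  -- (A record, so that the matrix can be recovered from the proposition.)
  record RowSumsOne {p q} (X : Mat R p q) : Set ℓ where
    constructor rowSumsOne
    field rowSum : ∀ a → ∑ q (X a) ≈ 1#
  open RowSumsOne

  Bistochastic : ∀ {p} → Mat R p p → Set ℓ
  Bistochastic X = RowSumsOne X × RowSumsOne (X ᵀ)

  rowSums-resp : ∀ {p q} {X Y : Mat R p q} → X ≈ₘ Y → RowSumsOne X → RowSumsOne Y
  rowSums-resp X≈Y rows = rowSumsOne λ a → trans (∑-cong (λ b → sym (X≈Y a b))) (rowSum rows a)

  rowSums-· : ∀ {p q r} {X : Mat R p q} {Y : Mat R q r} → RowSumsOne X → RowSumsOne Y → RowSumsOne (X · Y)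
  rowSums-· {q = q} {r} {X} {Y} rowsX rowsY = rowSumsOne λ a → begin
      ∑ r (λ b → ∑ q (λ k → X a k * Y k b))
        ≈⟨ ∑-comm (λ b k → X a k * Y k b) ⟩
      ∑ q (λ k → ∑ r (λ b → X a k * Y k b))
        ≈⟨ ∑-cong (λ k → sym (∑-*ˡ (X a k) (Y k))) ⟩
      ∑ q (λ k → X a k * ∑ r (Y k))
        ≈⟨ ∑-cong (λ k → trans (*-congˡ (rowSum rowsY k)) (*-identityʳ (X a k))) ⟩
      ∑ q (X a)
        ≈⟨ rowSum rowsX a ⟩
      1# ∎
    where open SetoidReasoning setoid

  bistochastic-· : ∀ {p} {X Y : Mat R p p} → Bistochastic X → Bistochastic Y → Bistochastic (X · Y)
  bistochastic-· {X = X} {Y} (rowsX , colsX) (rowsY , colsY) =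
    rowSums-· rowsX rowsY , rowSums-resp (≈ₘ-sym (ᵀ-· X Y)) (rowSums-· colsY colsX)

  rowSums-wsum : ∀ {A : Set} {p q} w (hs : List A) {Φ : A → Mat R p q} →
                 w * ℕ→R R (length hs) ≈ 1# → (∀ h → RowSumsOne (Φ h)) → RowSumsOne (wsum w hs Φ)
  rowSums-wsum {q = q} w hs {Φ} w|hs|≈1 rows = rowSumsOne λ a → begin
      ∑ q (λ b → w * lsum hs (λ h → Φ h a b))   ≈⟨ sym (∑-*ˡ w (λ b → lsum hs (λ h → Φ h a b))) ⟩
      w * ∑ q (λ b → lsum hs (λ h → Φ h a b))   ≈⟨ *-congˡ (∑-lsum hs (λ h → Φ h a)) ⟩
      w * lsum hs (λ h → ∑ q (Φ h a))           ≈⟨ *-congˡ (lsum-ones hs (λ h → rowSum (rows h) a)) ⟩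
      w * ℕ→R R (length hs)                     ≈⟨ w|hs|≈1 ⟩
      1#                                        ∎
    where open SetoidReasoning setoid

  bistochastic-wsum : ∀ {A : Set} {p} w (hs : List A) {Φ : A → Mat R p p} →
                      w * ℕ→R R (length hs) ≈ 1# → (∀ h → Bistochastic (Φ h)) → Bistochastic (wsum w hs Φ)
  bistochastic-wsum w hs w|hs|≈1 bis =
    rowSums-wsum w hs w|hs|≈1 (λ h → proj₁ (bis h)) , rowSums-wsum w hs w|hs|≈1 (λ h → proj₂ (bis h))

  P-Id : ∀ {p} (z : Fin p → Fin p) a b → P R z a b ≡ Id (z a) b
  P-Id z a b with z a ≟ b
  ... | yes _ = ≡.refl
  ... | no _  = ≡.refl

  -- With P(z)_{ab} = [z a = b], composition reverses: P(y ∘ h) = P(h) P(y).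
  P-∘ : ∀ {p} (y h : Fin p → Fin p) → P R (λ a → y (h a)) ≈ₘ P R h · P R y
  P-∘ {p} y h a c = sym (begin
      ∑ p (λ b → P R h a b * P R y b c)   ≈⟨ ∑-cong (λ b → *-congʳ (reflexive (P-Id h a b))) ⟩
      ∑ p (λ b → Id (h a) b * P R y b c)  ≈⟨ ∑-select (h a) (λ b → P R y b c) ⟩
      P R y (h a) c                       ≡⟨ P-Id y (h a) c ⟩
      Id (y (h a)) c                      ≡⟨ ≡.sym (P-Id (λ x → y (h x)) a c) ⟩
      P R (λ x → y (h x)) a c             ∎)
    where open SetoidReasoning setoid

  rowSums-P : ∀ {p} (z : Fin p → Fin p) → RowSumsOne (P R z)
  rowSums-P z = rowSumsOne λ a → trans (∑-cong (λ b → reflexive (P-Id z a b))) (∑-Id (z a))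

  module _ {p} (π : Permutation′ p) where
    private
      π-injective : Injective _≡_ _≡_ (π ⟨$⟩ʳ_)
      π-injective = Injection.injective (↔⇒↣ π)

    P-column : ∀ a b → P R (π ⟨$⟩ʳ_) a b ≡ Id (π ⟨$⟩ˡ b) a
    P-column a b = begin
        P R (π ⟨$⟩ʳ_) a b                       ≡⟨ P-Id (π ⟨$⟩ʳ_) a b ⟩
        Id (π ⟨$⟩ʳ a) b                         ≡⟨ ≡.cong (Id (π ⟨$⟩ʳ a)) (≡.sym (inverseʳ π)) ⟩
        Id (π ⟨$⟩ʳ a) (π ⟨$⟩ʳ (π ⟨$⟩ˡ b))       ≡⟨ Id-injective (π ⟨$⟩ʳ_) π-injective a (π ⟨$⟩ˡ b) ⟩
        Id a (π ⟨$⟩ˡ b)                         ≡⟨ Id-sym a (π ⟨$⟩ˡ b) ⟩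
        Id (π ⟨$⟩ˡ b) a                         ∎
      where open ≡.≡-Reasoning

    bistochastic-P : Bistochastic (P R (π ⟨$⟩ʳ_))
    bistochastic-P = rowSums-P (π ⟨$⟩ʳ_) , rowSumsOne λ b →
      trans (∑-cong (λ a → reflexive (P-column a b))) (∑-Id (π ⟨$⟩ˡ b))

    P-orthogonal : P R (π ⟨$⟩ʳ_) · P R (π ⟨$⟩ʳ_) ᵀ ≈ₘ Id
    P-orthogonal a c = begin
        ∑ p (λ b → Pπ a b * Pπ c b)           ≈⟨ ∑-cong (λ b → *-congʳ (reflexive (P-Id (π ⟨$⟩ʳ_) a b))) ⟩
        ∑ p (λ b → Id (π ⟨$⟩ʳ a) b * Pπ c b)  ≈⟨ ∑-select (π ⟨$⟩ʳ a) (Pπ c) ⟩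
        Pπ c (π ⟨$⟩ʳ a)                       ≡⟨ P-Id (π ⟨$⟩ʳ_) c (π ⟨$⟩ʳ a) ⟩
        Id (π ⟨$⟩ʳ c) (π ⟨$⟩ʳ a)              ≡⟨ Id-injective (π ⟨$⟩ʳ_) π-injective c a ⟩
        Id c a                                ≡⟨ Id-sym c a ⟩
        Id a c                                ∎
      where
      open SetoidReasoning setoid
      Pπ : Mat R p p
      Pπ = P R (π ⟨$⟩ʳ_)

module Conjugation {c ℓ} (R : CommutativeRing c ℓ) {m′ : ℕ}
                   (U : Mat R (suc m′) (suc m′)) (good : IsGoodU R m′ U) where
  open CommutativeRing R
  open LinearAlgebra R
  open IsGoodU good

  N : ℕ
  N = suc m′

  -- ρ¹ U z is, by definition, lower (conj (P z)).
  conj : Mat R N N → Mat R N N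
  conj X = (U ᵀ · X) · U

  conj-cong : ∀ {X Y} → X ≈ₘ Y → conj X ≈ₘ conj Y
  conj-cong X≈Y = ·-congʳ U (·-congˡ (U ᵀ) X≈Y)

  conj-· : ∀ X Y → conj X · conj Y ≈ₘ conj (X · Y)
  conj-· X Y = begin
      ((U ᵀ · X) · U) · ((U ᵀ · Y) · U)   ≈⟨ ·-assoc (U ᵀ · X) U ((U ᵀ · Y) · U) ⟩
      (U ᵀ · X) · (U · ((U ᵀ · Y) · U))   ≈⟨ ·-congˡ (U ᵀ · X) (≈ₘ-sym (·-assoc U (U ᵀ · Y) U)) ⟩
      (U ᵀ · X) · ((U · (U ᵀ · Y)) · U)   ≈⟨ ·-congˡ (U ᵀ · X) (·-congʳ U (≈ₘ-sym (·-assoc U (U ᵀ) Y))) ⟩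
      (U ᵀ · X) · (((U · U ᵀ) · Y) · U)   ≈⟨ ·-congˡ (U ᵀ · X) (·-congʳ U (·-congʳ Y orth)) ⟩
      (U ᵀ · X) · ((Id · Y) · U)          ≈⟨ ·-congˡ (U ᵀ · X) (·-congʳ U (·-idˡ Y)) ⟩
      (U ᵀ · X) · (Y · U)                 ≈⟨ ≈ₘ-sym (·-assoc (U ᵀ · X) Y U) ⟩
      ((U ᵀ · X) · Y) · U                 ≈⟨ ·-congʳ U (·-assoc (U ᵀ) X Y) ⟩
      (U ᵀ · (X · Y)) · U                 ∎
    where open SetoidReasoning (Mat-setoid N N)

  conj-ᵀ : ∀ X → conj X ᵀ ≈ₘ conj (X ᵀ)
  conj-ᵀ X = begin
      ((U ᵀ · X) · U) ᵀ     ≈⟨ ᵀ-· (U ᵀ · X) U ⟩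
      U ᵀ · (U ᵀ · X) ᵀ     ≈⟨ ·-congˡ (U ᵀ) (ᵀ-· (U ᵀ) X) ⟩
      U ᵀ · (X ᵀ · U)       ≈⟨ ≈ₘ-sym (·-assoc (U ᵀ) (X ᵀ) U) ⟩
      (U ᵀ · X ᵀ) · U       ∎
    where open SetoidReasoning (Mat-setoid N N)

  conj-gram : ∀ X → conj X · conj X ᵀ ≈ₘ conj (X · X ᵀ)
  conj-gram X = ≈ₘ-trans (·-congˡ (conj X) (conj-ᵀ X)) (conj-· X (X ᵀ))

  unconj : ∀ X → (U · conj X) · U ᵀ ≈ₘ X
  unconj X = begin
      (U · ((U ᵀ · X) · U)) · U ᵀ   ≈⟨ ·-congʳ (U ᵀ) (≈ₘ-sym (·-assoc U (U ᵀ · X) U)) ⟩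
      ((U · (U ᵀ · X)) · U) · U ᵀ   ≈⟨ ·-assoc (U · (U ᵀ · X)) U (U ᵀ) ⟩
      (U · (U ᵀ · X)) · (U · U ᵀ)   ≈⟨ ·-congˡ (U · (U ᵀ · X)) orth ⟩
      (U · (U ᵀ · X)) · Id          ≈⟨ ·-idʳ (U · (U ᵀ · X)) ⟩
      U · (U ᵀ · X)                 ≈⟨ ≈ₘ-sym (·-assoc U (U ᵀ) X) ⟩
      (U · U ᵀ) · X                 ≈⟨ ·-congʳ X orth ⟩
      Id · X                        ≈⟨ ·-idˡ X ⟩
      X                             ∎
    where open SetoidReasoning (Mat-setoid N N)

  conj-wsum : ∀ {A : Set} w (hs : List A) (Φ : A → Mat R N N) →
              conj (wsum w hs Φ) ≈ₘ wsum w hs (λ h → conj (Φ h))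
  conj-wsum w hs Φ =
    ≈ₘ-trans (·-congʳ U (wsum-·ˡ w hs (U ᵀ) Φ)) (wsum-·ʳ w hs (λ h → U ᵀ · Φ h) U)

  stochastic-fixes-U₀ : ∀ {X} → RowSumsOne X → ∀ b → (X · U) b fzero ≈ U b fzero
  stochastic-fixes-U₀ {X} rows b = begin
      ∑ N (λ k → X b k * U k fzero)   ≈⟨ ∑-cong (λ k → *-congˡ {X b k} (firstCol k)) ⟩
      ∑ N (λ k → X b k * s)           ≈⟨ sym (∑-*ʳ s (X b)) ⟩
      ∑ N (X b) * s                   ≈⟨ *-congʳ (RowSumsOne.rowSum rows b) ⟩
      1# * s                          ≈⟨ *-identityˡ s ⟩
      s                               ≈⟨ sym (firstCol b) ⟩
      U b fzero                       ∎
    where open SetoidReasoning setoid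

  conj-firstColumn : ∀ {X} → RowSumsOne X → ∀ a → conj X a fzero ≈ Id a fzero
  conj-firstColumn {X} rows a = begin
      conj X a fzero
        ≈⟨ ·-assoc (U ᵀ) X U a fzero ⟩
      ∑ N (λ b → U b a * (X · U) b fzero)
        ≈⟨ ∑-cong (λ b → *-congˡ {U b a} (stochastic-fixes-U₀ rows b)) ⟩
      (U ᵀ · U) a fzero
        ≈⟨ orthᵗ a fzero ⟩
      Id a fzero ∎
    where open SetoidReasoning setoid

  conj-firstRow : ∀ {X} → RowSumsOne (X ᵀ) → ∀ b → conj X fzero b ≈ Id fzero b
  conj-firstRow {X} cols b =
    trans (conj-ᵀ X b fzero) (trans (conj-firstColumn cols b) (reflexive (Id-sym b fzero)))

  conj-e₀e₀ᵀ : ∀ {X} → Bistochastic X → (∀ i j → lower (conj X) i j ≈ 0#) → conj X ≈ₘ e₀e₀ᵀ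
  conj-e₀e₀ᵀ (_ , cols) _ fzero    b     = trans (conj-firstRow cols b) (sym (*-identityˡ _))
  conj-e₀e₀ᵀ (rows , _) _ (fsuc i) fzero = trans (conj-firstColumn rows (fsuc i)) (sym (zeroˡ _))
  conj-e₀e₀ᵀ _ lower≈0 (fsuc i) (fsuc j) = trans (lower≈0 i j) (sym (zeroˡ _))

module CosetMeans {c ℓ} (R : CommutativeRing c ℓ) {m′ : ℕ}
                  (U : Mat R (suc m′) (suc m′)) (good : IsGoodU R m′ U)
                  (hs : List (Permutation′ (suc m′))) (hinv : CommutativeRing.Carrier R)
                  (hinv|hs|≈1 : CommutativeRing._≈_ R (CommutativeRing._*_ R hinv (ℕ→R R (length hs)))
                                                      (CommutativeRing.1# R)) where
  open CommutativeRing R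
  open LinearAlgebra R
  open Conjugation R U good
  open IsGoodU good

  _∘ₚ_ : Permutation′ N → Permutation′ N → Fin N → Fin N
  (y ∘ₚ h) a = y ⟨$⟩ʳ (h ⟨$⟩ʳ a)

  Q : Permutation′ N → Mat R N N
  Q y = wsum hinv hs (λ h → P R (y ∘ₚ h))

  Q₀ : Mat R N N
  Q₀ = wsum hinv hs (λ h → P R (h ⟨$⟩ʳ_))

  W : Mat R N N
  W = Q₀ · Q₀ ᵀ

  M : Mat R m′ m′
  M = lower (conj W)

  -- G y = (1/|H|) Σ_h Uᵀ P(y ∘ h) U; its lower block is gCoset R U hs hinv y by definition.
  G : Permutation′ N → Mat R N N
  G y = wsum hinv hs (λ h → conj (P R (y ∘ₚ h)))

  G≈conj-Q : ∀ y → G y ≈ₘ conj (Q y)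
  G≈conj-Q y = ≈ₘ-sym (conj-wsum hinv hs (λ h → P R (y ∘ₚ h)))

  -- Q y = Q₀ P(y), because P(y ∘ h) = P(h) P(y).
  Q-factor : ∀ y → Q y ≈ₘ Q₀ · P R (y ⟨$⟩ʳ_)
  Q-factor y = ≈ₘ-trans (wsum-cong hinv hs (λ h → P-∘ (y ⟨$⟩ʳ_) (h ⟨$⟩ʳ_)))
                        (≈ₘ-sym (wsum-·ʳ hinv hs (λ h → P R (h ⟨$⟩ʳ_)) (P R (y ⟨$⟩ʳ_))))

  -- Since P(y) is orthogonal, the Gram matrix of Q y does not depend on y.
  Q-gram : ∀ y → Q y · Q y ᵀ ≈ₘ W
  Q-gram y = ≈ₘ-trans (·-cong (Q-factor y) (λ i j → Q-factor y j i))
                      (gram-orthogonal Q₀ {P R (y ⟨$⟩ʳ_)} (P-orthogonal y))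

  G-gram : ∀ y → G y · G y ᵀ ≈ₘ conj W
  G-gram y = begin
      G y · G y ᵀ                 ≈⟨ ·-cong (G≈conj-Q y) (λ i j → G≈conj-Q y j i) ⟩
      conj (Q y) · conj (Q y) ᵀ   ≈⟨ conj-gram (Q y) ⟩
      conj (Q y · Q y ᵀ)          ≈⟨ conj-cong (Q-gram y) ⟩
      conj W                      ∎
    where open SetoidReasoning (Mat-setoid N N)

  -- Q y is stochastic, so the first column of G y is e₀.
  G-firstColumn : ∀ y i → G y (fsuc i) fzero ≈ 0#
  G-firstColumn y i = trans (G≈conj-Q y (fsuc i) fzero) (conj-firstColumn Q-stochastic (fsuc i))
    where
    Q-stochastic : RowSumsOne (Q y)
    Q-stochastic = rowSums-wsum hinv hs hinv|hs|≈1 (λ h → rowSums-P (y ∘ₚ h))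

  coset-gram : ∀ y → _≈M_ R (_⊗_ R (gCoset R U hs hinv y) (ᵗ R (gCoset R U hs hinv y))) M
  coset-gram y = ≈ₘ-trans (lower-· (G y) (G y ᵀ) (G-firstColumn y)) (λ i j → G-gram y (fsuc i) (fsuc j))

  W-bistochastic : Bistochastic W
  W-bistochastic = bistochastic-· Q₀-bistochastic (proj₂ Q₀-bistochastic , proj₁ Q₀-bistochastic)
    where
    Q₀-bistochastic : Bistochastic Q₀
    Q₀-bistochastic = bistochastic-wsum hinv hs hinv|hs|≈1 (λ h → bistochastic-P h)

  -- If M vanishes, then Uᵀ W U = e₀e₀ᵀ, so every entry of W = U e₀e₀ᵀ Uᵀ equals s².
  W-constant : (∀ i j → M i j ≈ 0#) → ∀ a b → W a b ≈ s * s
  W-constant M≈0 a b = begin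
      W a b                           ≈⟨ unconj W a b ⟨
      ((U · conj W) · U ᵀ) a b        ≈⟨ ·-congʳ (U ᵀ) (·-congˡ U (conj-e₀e₀ᵀ W-bistochastic M≈0)) a b ⟩
      ((U · e₀e₀ᵀ) · U ᵀ) a b         ≈⟨ sandwich-e₀e₀ᵀ U (U ᵀ) a b ⟩
      U a fzero * U b fzero           ≈⟨ *-cong (firstCol a) (firstCol b) ⟩
      s * s                           ∎
    where open SetoidReasoning setoid

  module Blocks {k} (blk : Fin N → Fin k)
                (preserves : ∀ h → h ∈ₚ hs → ∀ a → blk (h ⟨$⟩ʳ a) ≡ blk a) where

    Q₀-blockDiagonal : ∀ {a c} → ¬ blk a ≡ blk c → Q₀ a c ≈ 0#
    Q₀-blockDiagonal {a} {c} a≁c = trans (*-congˡ (lsum-zero hs term)) (zeroʳ hinv)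
      where
      term : ∀ h → h ∈ₚ hs → P R (h ⟨$⟩ʳ_) a c ≈ 0#
      term h h∈hs = reflexive (≡.trans (P-Id (h ⟨$⟩ʳ_) a c)
        (Id-off (λ ha≡c → a≁c (≡.trans (≡.sym (preserves h h∈hs a)) (≡.cong blk ha≡c)))))

    W-blockDiagonal : ∀ {a b} → ¬ blk a ≡ blk b → W a b ≈ 0#
    W-blockDiagonal {a} {b} a≁b = ∑-zero term
      where
      term : ∀ c → Q₀ a c * Q₀ b c ≈ 0#
      term c with blk c ≟ blk a
      ... | yes c∼a = trans (*-congˡ (Q₀-blockDiagonal b≁c)) (zeroʳ _)
        where
        b≁c : ¬ blk b ≡ blk c
        b≁c b∼c = a≁b (≡.trans (≡.sym c∼a) (≡.sym b∼c))
      ... | no c≁a  = trans (*-congʳ (Q₀-blockDiagonal (λ a∼c → c≁a (≡.sym a∼c)))) (zeroˡ _)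

  -- Second claim: for a fixing H (in a nontrivial ring) M ≠ 0.  Two points a, b in
  -- different blocks give s² = W a b = 0, contradicting s² m = 1.
  M-nonzero : ¬ (1# ≈ 0#) → IsFixing N hs → ¬ (∀ i j → M i j ≈ 0#)
  M-nonzero 1≉0 (suc (suc k) , blk , s≤s (s≤s _) , onto , fixing) M≈0 = 1≉0 (begin
      1#                    ≈⟨ s²m≈1 ⟨
      s * s * ℕ→R R N       ≈⟨ *-congʳ s²≈0 ⟩
      0# * ℕ→R R N          ≈⟨ zeroˡ _ ⟩
      0#                    ∎)
    where
    open SetoidReasoning setoid
    open Blocks blk (λ h h∈hs → proj₁ (proj₁ (fixing h) h∈hs))
    a b : Fin N
    a = proj₁ (onto fzero)
    b = proj₁ (onto (fsuc fzero))
    a≁b : ¬ blk a ≡ blk b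
    a≁b a∼b with ≡.trans (≡.sym (proj₂ (onto fzero))) (≡.trans a∼b (proj₂ (onto (fsuc fzero))))
    ... | ()
    s²≈0 : s * s ≈ 0#
    s²≈0 = trans (sym (W-constant M≈0 a b)) (W-blockDiagonal a≁b)

claim6p9 : ∀ {c ℓ : Level} (R : CommutativeRing c ℓ) →
    ¬ (CommutativeRing._≈_ R (CommutativeRing.1# R) (CommutativeRing.0# R)) →
    (m′ : ℕ) (U : Mat R (suc m′) (suc m′)) → IsGoodU R m′ U →
    (hs : List (Permutation′ (suc m′))) → IsSubgroupList (suc m′) hs →
    (hinv : CommutativeRing.Carrier R) →
    CommutativeRing._≈_ R (CommutativeRing._*_ R hinv (ℕ→R R (length hs))) (CommutativeRing.1# R) →
    Σ (Mat R m′ m′) λ M →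
      (∀ (y : Permutation′ (suc m′)) →
         _≈M_ R (_⊗_ R (gCoset R U hs hinv y) (ᵗ R (gCoset R U hs hinv y))) M)
      × (IsFixing (suc m′) hs → ¬ (∀ i j → CommutativeRing._≈_ R (M i j) (CommutativeRing.0# R)))
      × (∀ (n : ℕ) (f : (Fin n → Permutation′ (suc m′)) → Permutation′ (suc m′))
           (x : Fin n → Permutation′ (suc m′)) →
         _≈M_ R (_⊗_ R (gCoset R U hs hinv (f x)) (ᵗ R (gCoset R U hs hinv (f x)))) M)
claim6p9 R 1≉0 m′ U good hs _ hinv hinv|hs|≈1 =
  M , coset-gram , M-nonzero 1≉0 , (λ n f x → coset-gram (f x))
  where open CosetMeans R U good hs hinv hinv|hs|≈1
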